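{- Let $G$ and $H$ be two non-trivial connected graphs of order $n_1$ and $n_2$, having $t_1$ and $t_2$ true twin equivalence classes, respectively. Then the vertex set of $G\boxtimes H$ is partitioned into $t_1t_2$ true twin equivalence classes.
   Context: Two vertices $u,v$ of a graph $G$ are true twins if $N_G[u]=N_G[v]$, where $N_G[v]$ is the closed neighborhood. The true twin equivalence relation is $x\,\mathcal{R}\,y \iff N_G[x]=N_G[y]$; its classes are the true twin equivalence classes. The strong product $G\boxtimes H$ has vertex set $V(G)\times V(H)$, with $(a,b)\sim(c,d)$ iff ($a=c$ and $b\sim d$) or ($b=d$ and $a\sim c$) or ($a\sim c$ and $b\sim d$). -}

module Defs where

open import Level using (0ℓ)
open import Data.Nat using (ℕ; _≥_)
open import Data.Fin using (Fin)
open import Data.Product using (_×_; _,_; Σ; ∃-syntax)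
open import Data.Sum using (_⊎_; inj₁; inj₂)
open import Data.List using (List; []; _∷_)
open import Relation.Nullary using (¬_; Dec)
open import Relation.Binary.PropositionalEquality using (_≡_; refl)
open import Function.Bundles using (_⇔_; _↔_)

record Graph (V : Set) : Set₁ where
  field
    Adj      : V → V → Set
    sym      : ∀ {x y} → Adj x y → Adj y x
    irrefl   : ∀ {x} → ¬ Adj x x
open Graph public

HasOrder : {V : Set} → Graph V → ℕ → Set
HasOrder {V} _ n = V ↔ Fin n

data Walk {V : Set} (G : Graph V) : V → V → Set where
  here : ∀ {x} → Walk G x x
  step : ∀ {x y z} → Adj G x y → Walk G y z → Walk G x z

Connected : {V : Set} → Graph V → Set
Connected {V} G = ∀ (x y : V) → Walk G x y

InClosedNbhd : {V : Set} → Graph V → V → V → Set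
InClosedNbhd G x w = (w ≡ x) ⊎ Adj G x w

TrueTwins : {V : Set} → Graph V → V → V → Set
TrueTwins G x y = ∀ w → InClosedNbhd G x w ⇔ InClosedNbhd G y w

-- G has exactly t true twin equivalence classes: there is a surjective map
-- from vertices onto Fin t whose fibres are exactly the true twin classes
-- (i.e. the quotient V/ℛ is in bijection with Fin t).
HasTwinClasses : {V : Set} → Graph V → ℕ → Set
HasTwinClasses {V} G t =
  Σ (V → Fin t) λ f →
    (∀ (i : Fin t) → ∃[ x ] f x ≡ i) ×
    (∀ (x y : V) → (f x ≡ f y) ⇔ TrueTwins G x y)

StrongAdj : {V W : Set} → Graph V → Graph W → V × W → V × W → Set
StrongAdj G H (a , b) (c , d) =
  ((a ≡ c) × Adj H b d) ⊎ ((b ≡ d) × Adj G a c) ⊎ (Adj G a c × Adj H b d)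

⊠-sym : {V W : Set} (G : Graph V) (H : Graph W) → ∀ {p q} → StrongAdj G H p q → StrongAdj G H q p
⊠-sym G H (inj₁ (refl , h)) = inj₁ (refl , sym H h)
⊠-sym G H (inj₂ (inj₁ (refl , g))) = inj₂ (inj₁ (refl , sym G g))
⊠-sym G H (inj₂ (inj₂ (g , h))) = inj₂ (inj₂ (sym G g , sym H h))

⊠-irrefl : {V W : Set} (G : Graph V) (H : Graph W) → ∀ {p} → ¬ StrongAdj G H p p
⊠-irrefl G H (inj₁ (_ , h)) = irrefl H h
⊠-irrefl G H (inj₂ (inj₁ (_ , g))) = irrefl G g
⊠-irrefl G H (inj₂ (inj₂ (g , _))) = irrefl G g

_⊠_ : {V W : Set} → Graph V → Graph W → Graph (V × W)
G ⊠ H = record { Adj = StrongAdj G H ; sym = ⊠-sym G H ; irrefl = ⊠-irrefl G H }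

-- The closed neighbourhood of (a , b) in G ⊠ H is N[a] × N[b]. Since every vertex lies in
-- its own closed neighbourhood, these factors can be read back off the product, so
-- (a , b) and (c , d) are true twins exactly when a, c are twins in G and b, d in H.
-- The twin classes of G ⊠ H are therefore the products of twin classes of the factors.
module Submission where

open import Defs
open import Data.Nat using (ℕ; _*_; _≥_)
open import Data.Product using (_×_; _,_; proj₁; proj₂; Σ; ∃-syntax)
open import Data.Product.Function.NonDependent.Propositional using (_×-⇔_)
open import Data.Product.Relation.Binary.Pointwise.NonDependent using (Pointwise)
open import Data.Sum using (inj₁; inj₂)
open import Data.Fin using (Fin; combine; remQuot)
open import Data.Fin.Properties using (combine-remQuot; combine-injectiveˡ; combine-injectiveʳ)
open import Function.Bundles using (_⇔_; mk⇔; Equivalence)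
open import Function.Properties.Equivalence using () renaming (sym to ⇔-sym; trans to ⇔-trans)
open import Relation.Binary.PropositionalEquality using (_≡_; refl; cong₂; trans)

open Equivalence

Classification : {A : Set} → (A → A → Set) → ℕ → Set
Classification {A} R t =
  Σ (A → Fin t) λ f →
    (∀ (i : Fin t) → ∃[ x ] f x ≡ i) ×
    (∀ (x y : A) → (f x ≡ f y) ⇔ R x y)

classification-cong : {A : Set} {R S : A → A → Set} {t : ℕ} →
  (∀ x y → R x y ⇔ S x y) → Classification R t → Classification S t
classification-cong R⇔S (f , surj , fibres) =
  f , surj , λ x y → ⇔-trans (fibres x y) (R⇔S x y)

combine-≡⇔ : {m n : ℕ} (i k : Fin m) (j l : Fin n) →
  (combine i j ≡ combine k l) ⇔ (i ≡ k × j ≡ l)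
combine-≡⇔ i k j l = mk⇔
  (λ eq → combine-injectiveˡ i j k l eq , combine-injectiveʳ i j k l eq)
  (λ { (refl , refl) → refl })

classification-× : {A B : Set} {R : A → A → Set} {S : B → B → Set} {s t : ℕ} →
  Classification R s → Classification S t → Classification (Pointwise R S) (s * t)
classification-× {A} {B} {R} {S} {s} {t} (f , surjf , fibresf) (g , surjg , fibresg) =
  h , surjh , fibresh
  where
  h : A × B → Fin (s * t)
  h (a , b) = combine (f a) (g b)

  surjh : ∀ i → ∃[ x ] h x ≡ i
  surjh i with surjf (proj₁ (remQuot {s} t i)) | surjg (proj₂ (remQuot {s} t i))
  ... | a , fa≡j | b , gb≡k = (a , b) , trans (cong₂ combine fa≡j gb≡k) (combine-remQuot {s} t i)

  fibresh : ∀ x y → (h x ≡ h y) ⇔ Pointwise R S x y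
  fibresh (a , b) (c , d) =
    ⇔-trans (combine-≡⇔ (f a) (f c) (g b) (g d)) (fibresf a c ×-⇔ fibresg b d)

module _ {V W : Set} (G : Graph V) (H : Graph W) where

  closedNbhd-⊠ : ∀ {a b u v} →
    InClosedNbhd (G ⊠ H) (a , b) (u , v) ⇔ (InClosedNbhd G a u × InClosedNbhd H b v)
  closedNbhd-⊠ = mk⇔ split join
    where
    split : ∀ {a b u v} → InClosedNbhd (G ⊠ H) (a , b) (u , v) →
            InClosedNbhd G a u × InClosedNbhd H b v
    split (inj₁ refl)                      = inj₁ refl , inj₁ refl
    split (inj₂ (inj₁ (refl , bv)))        = inj₁ refl , inj₂ bv
    split (inj₂ (inj₂ (inj₁ (refl , au)))) = inj₂ au , inj₁ refl
    split (inj₂ (inj₂ (inj₂ (au , bv))))   = inj₂ au , inj₂ bv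

    join : ∀ {a b u v} → InClosedNbhd G a u × InClosedNbhd H b v →
           InClosedNbhd (G ⊠ H) (a , b) (u , v)
    join (inj₁ refl , inj₁ refl) = inj₁ refl
    join (inj₁ refl , inj₂ bv)   = inj₂ (inj₁ (refl , bv))
    join (inj₂ au   , inj₁ refl) = inj₂ (inj₂ (inj₁ (refl , au)))
    join (inj₂ au   , inj₂ bv)   = inj₂ (inj₂ (inj₂ (au , bv)))

  trueTwins-⊠ : ∀ a b c d →
    TrueTwins (G ⊠ H) (a , b) (c , d) ⇔ (TrueTwins G a c × TrueTwins H b d)
  trueTwins-⊠ a b c d = mk⇔ factors product
    where
    product : TrueTwins G a c × TrueTwins H b d → TrueTwins (G ⊠ H) (a , b) (c , d)
    product (ac , bd) (u , v) =
      ⇔-trans closedNbhd-⊠ (⇔-trans (ac u ×-⇔ bd v) (⇔-sym closedNbhd-⊠))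

    -- Probe N[(a , b)] with vertices (u , b) and (a , v), using b ∈ N[b] and a ∈ N[a].
    factors : TrueTwins (G ⊠ H) (a , b) (c , d) → TrueTwins G a c × TrueTwins H b d
    factors twins = (λ u → mk⇔ (λ au → proj₁ (to   (twinsAt (u , b)) (au , inj₁ refl)))
                                (λ cu → proj₁ (from (twinsAt (u , d)) (cu , inj₁ refl))))
                  , (λ v → mk⇔ (λ bv → proj₂ (to   (twinsAt (a , v)) (inj₁ refl , bv)))
                                (λ dv → proj₂ (from (twinsAt (c , v)) (inj₁ refl , dv))))
      where
      twinsAt : ∀ w → (InClosedNbhd G a (proj₁ w) × InClosedNbhd H b (proj₂ w)) ⇔
                      (InClosedNbhd G c (proj₁ w) × InClosedNbhd H d (proj₂ w))
      twinsAt (u , v) = ⇔-trans (⇔-sym closedNbhd-⊠) (⇔-trans (twins (u , v)) closedNbhd-⊠)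

lemma9 : {V W : Set} (G : Graph V) (H : Graph W) (n₁ n₂ t₁ t₂ : ℕ) →
    HasOrder G n₁ → HasOrder H n₂ → n₁ ≥ 2 → n₂ ≥ 2 →
    Connected G → Connected H →
    HasTwinClasses G t₁ → HasTwinClasses H t₂ →
    HasTwinClasses (G ⊠ H) (t₁ * t₂)
lemma9 G H _ _ _ _ _ _ _ _ _ _ classesG classesH =
  classification-cong (λ { (a , b) (c , d) → ⇔-sym (trueTwins-⊠ G H a b c d) })
                      (classification-× classesG classesH)
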